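{- Let $x$ be the center of an induced star $Q=G^0[U]$ and let $I=U\setminus \{x\}$. Then there is a set $X\subseteq U$ such that $w_X(Q)\ge |I|$.
   Context: Let $F$ be a 2-CNF formula (a multiset of clauses, each consisting of exactly two literals over distinct variables) with $m$ clauses, and assume $F$ contains no semicomplete subset (i.e., no 4 clauses that pairwise have a conflict, where two clauses conflict if one contains a literal $p$ and the other contains its negation $\overline{p}$). For a literal $x$, $c(x)$ is the number of clauses of $F$ containing $x$; for literals $x,y$ with $x\neq\overline{y}$, $c(xy)$ is the number of occurrences of the clause $xy$ in $F$. The auxiliary graph $G=(V,E)$ has $V=\mathrm{var}(F)$ and $xy\in E$ iff some clause $C\in F$ has $\mathrm{var}(C)=\{x,y\}$. Vertex and edge weights are $w(x)=c(x)-c(\overline{x})$ and $w(xy)=c(x\overline{y})+c(\overline{x}y)-c(xy)-c(\overline{x}\,\overline{y})$; for $U\subseteq V$, $H\subseteq E$, $w(U)=\sum_{x\in U}w(x)$, $w(H)=\sum_{xy\in H}w(xy)$, and the weight of a subgraph $Q=(U,H)$ is $w(Q)=w(U)+w(H)$. $G^0$ is obtained from $G$ by removing all edges of weight zero, and $G^0[U]$ denotes the subgraph of $G^0$ induced by $U$. For $X\subseteq \mathrm{var}(F)$, $F_X$ is obtained from $F$ by replacing $x$ with $\overline{x}$ and $\overline{x}$ with $x$ for each $x\in X$ (switching $X$), and $w_X(\cdot)$ denotes the weights computed for $F_X$; equivalently, $w_X$ is obtained from $w$ by reversing the signs of the weights of all vertices in $X$ and of all edges between $X$ and $V\setminus X$.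 $G^0[U]$ is an induced star with center $x$ if $x$ is a vertex of $G^0$, $I$ is an independent set in the subgraph of $G^0$ induced by the neighbors of $x$, and $U=\{x\}\cup I$. -}

module Defs where

open import Data.Nat as ℕ using (ℕ; zero; suc)
open import Data.Bool using (Bool; true; false; not; _∧_; _∨_; if_then_else_)
import Data.Bool as B
open import Data.Fin using (Fin; toℕ)
import Data.Fin as F
open import Data.Fin.Subset using (Subset; _∈_; _⊆_; ⁅_⁆; _∪_; ∣_∣)
open import Data.Fin.Subset.Properties using (_∈?_)
open import Data.Integer as ℤ using (ℤ; +_; _-_)
open import Data.List using (List; []; _∷_; map; length; lookup)
open import Data.List.Relation.Unary.Any using (Any; any?)
open import Data.Product using (_×_; _,_; Σ; ∃; ∃-syntax)
open import Data.Sum using (_⊎_)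
open import Function.Definitions using (Injective)
open import Relation.Binary.PropositionalEquality using (_≡_; _≢_)
open import Relation.Nullary using (¬_; Dec; does; yes; no)
open import Relation.Nullary.Decidable using (⌊_⌋; _×-dec_; _⊎-dec_; ¬?)

-- A literal: a variable together with a polarity (true = positive x,
-- false = negated x̄).
record Literal (n : ℕ) : Set where
  constructor lit
  field
    var : Fin n
    pos : Bool
open Literal public

neg : ∀ {n} → Literal n → Literal n
neg (lit v b) = lit v (not b)

_==_ : ∀ {n} → Literal n → Literal n → Bool
lit u a == lit v b = ⌊ u F.≟ v ⌋ ∧ ⌊ a B.≟ b ⌋

record Clause (n : ℕ) : Set where
  constructor clause
  field
    l₁ l₂ : Literal n
    distinct : var l₁ ≢ var l₂
open Clause public

-- A 2-CNF formula is a multiset of clauses, represented as a list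
Formula : ℕ → Set
Formula n = List (Clause n)

contains : ∀ {n} → Clause n → Literal n → Bool
contains C p = (l₁ C == p) ∨ (l₂ C == p)

count : ∀ {A : Set} → (A → Bool) → List A → ℕ
count t [] = 0
count t (a ∷ as) = if t a then suc (count t as) else count t as

c : ∀ {n} → Formula n → Literal n → ℕ
c F p = count (λ C → contains C p) F

c₂ : ∀ {n} → Formula n → Literal n → Literal n → ℕ
c₂ F p q = count (λ C → ((l₁ C == p) ∧ (l₂ C == q)) ∨ ((l₁ C == q) ∧ (l₂ C == p))) F

Conflict : ∀ {n} → Clause n → Clause n → Set
Conflict C D = ∃[ p ] (contains C p ≡ true × contains D (neg p) ≡ true)

-- a semicomplete subset: 4 clauses of F (distinct members of the
-- multiset, i.e. distinct positions) that pairwise conflict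
HasSemicomplete : ∀ {n} → Formula n → Set
HasSemicomplete F =
  Σ (Fin 4 → Fin (length F)) λ f →
    Injective _≡_ _≡_ f ×
    (∀ a b → a ≢ b → Conflict (lookup F (f a)) (lookup F (f b)))

posL negL : ∀ {n} → Fin n → Literal n
posL x = lit x true
negL x = lit x false

wV : ∀ {n} → Formula n → Fin n → ℤ
wV F x = + c F (posL x) - + c F (negL x)

wE : ∀ {n} → Formula n → Fin n → Fin n → ℤ
wE F x y = (+ c₂ F (posL x) (negL y) ℤ.+ + c₂ F (negL x) (posL y))
           - + c₂ F (posL x) (posL y) - + c₂ F (negL x) (negL y)

switchLit : ∀ {n} → Subset n → Literal n → Literal n
switchLit X p with var p ∈? X
... | yes _ = neg p
... | no  _ = p

switchClause : ∀ {n} → Subset n → Clause n → Clause n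
switchClause X (clause a b d) = clause (switchLit X a) (switchLit X b) (λ e → d (lemma a b e))
  where
  varSw : ∀ p → var (switchLit X p) ≡ var p
  varSw p with var p ∈? X
  ... | yes _ = _≡_.refl
  ... | no  _ = _≡_.refl
  lemma : ∀ a b → var (switchLit X a) ≡ var (switchLit X b) → var a ≡ var b
  lemma a b e rewrite varSw a | varSw b = e

switch : ∀ {n} → Subset n → Formula n → Formula n
switch X F = map (switchClause X) F

IsVar : ∀ {n} → Formula n → Fin n → Set
IsVar F x = Any (λ C → var (l₁ C) ≡ x ⊎ var (l₂ C) ≡ x) F

EdgeG : ∀ {n} → Formula n → Fin n → Fin n → Set
EdgeG F x y = Any (λ C → (var (l₁ C) ≡ x × var (l₂ C) ≡ y) ⊎ (var (l₁ C) ≡ y × var (l₂ C) ≡ x)) F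

edgeG? : ∀ {n} (F : Formula n) x y → Dec (EdgeG F x y)
edgeG? F x y = any? (λ C → ((var (l₁ C) F.≟ x) ×-dec (var (l₂ C) F.≟ y))
                      ⊎-dec ((var (l₁ C) F.≟ y) ×-dec (var (l₂ C) F.≟ x))) F

Edge0 : ∀ {n} → Formula n → Fin n → Fin n → Set
Edge0 F x y = EdgeG F x y × wE F x y ≢ + 0

edge0? : ∀ {n} (F : Formula n) x y → Dec (Edge0 F x y)
edge0? F x y = edgeG? F x y ×-dec ¬? (wE F x y ℤ.≟ + 0)

-- G⁰[U] is an induced star with center x and leaf set I:
-- x is a vertex of G⁰ (i.e. x ∈ var(F)), every element of I is a
-- G⁰-neighbour of x, and I is independent in G⁰.  Then U = {x} ∪ I.
IsInducedStar : ∀ {n} → Formula n → Fin n → Subset n → Set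
IsInducedStar F x I =
  IsVar F x ×
  (∀ y → y ∈ I → Edge0 F x y) ×
  (∀ y z → y ∈ I → z ∈ I → ¬ Edge0 F y z)

sumFin : ∀ n → (Fin n → ℤ) → ℤ
sumFin zero f = + 0
sumFin (suc n) f = f F.zero ℤ.+ sumFin n (λ i → f (F.suc i))

wSet : ∀ {n} → Formula n → Subset n → ℤ
wSet {n} F' U = sumFin n λ v → if does (v ∈? U) then wV F' v else + 0

-- w'(H) where H is the edge set of G⁰[U] (G⁰ of formula F), each
-- unordered edge {u,v} counted once (u < v), weights from formula F'
wEdgesInduced : ∀ {n} → Formula n → Formula n → Subset n → ℤ
wEdgesInduced {n} F' F U =
  sumFin n λ u → sumFin n λ v →
    if does (toℕ u ℕ.<? toℕ v) ∧ does (u ∈? U) ∧ does (v ∈? U) ∧ does (edge0? F u v)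
    then wE F' u v else + 0

wInduced : ∀ {n} → Formula n → Formula n → Subset n → ℤ
wInduced F' F U = wSet F' U ℤ.+ wEdgesInduced F' F U

module Submission where

-- Write a(v) = w(v) and b(v) = w(xv).
-- Switching a set X negates w(v) for v ∈ X and w(uv) when exactly one of
-- u, v lies in X.  Since Q = G⁰[U] is a star with centre x and leaves I,
-- its weight is w(x) + Σ_{v ∈ I} (w(v) + w(xv)).  Consider the two sets
--   X₁ = {v ∈ I : a(v) + b(v) < 0},   X₂ = {x} ∪ {v ∈ I : a(v) − b(v) < 0}.
-- Then w_{X₁}(Q) = a(x) + Σ_{v ∈ I} |a(v) + b(v)| and
--      w_{X₂}(Q) = −a(x) + Σ_{v ∈ I} |a(v) − b(v)|, so their sum is
-- Σ_{v ∈ I} (|a + b| + |a − b|) ≥ Σ_{v ∈ I} 2|b(v)| ≥ 2|I|, because every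
-- edge xv of G⁰ has nonzero weight.  Hence one of them is at least |I|.

open import Defs
open import Data.Nat as ℕ using (zero; suc)
import Data.Nat.Properties as ℕP
open import Data.Bool as B using (Bool; true; false; not; _∧_; _∨_; _xor_; if_then_else_)
open import Data.Bool.Properties using (not-involutive; ∨-comm)
open import Data.Fin as F using (Fin; toℕ)
import Data.Fin.Properties as FP
open import Data.Fin.Subset using (Subset; _∈_; _⊆_; ⁅_⁆; _∪_; ∣_∣)
open import Data.Fin.Subset.Properties using (_∈?_; ∪⇔⊎; x∈⁅y⁆⇔x≡y)
open import Data.Integer as ℤ using (ℤ; +_; _+_; _*_; _-_; -_; _≤_)
import Data.Integer.Properties as ℤP
open import Data.Integer.Tactic.RingSolver using (solve-∀)
open import Data.List using ([]; _∷_; map)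
open import Data.List.Relation.Unary.Any using (here; there)
import Data.List.Relation.Unary.Any as Any
open import Data.Vec using ([]; _∷_; tabulate)
open import Data.Empty using (⊥)
open import Data.Product using (Σ; _×_; _,_; proj₁; proj₂)
open import Data.Sum as Sum using (_⊎_; inj₁; inj₂)
open import Function using (_∘_)
open import Function.Bundles using (_⇔_; mk⇔; Equivalence)
open import Relation.Binary.Definitions using (DecidableEquality; tri<; tri≈; tri>)
open import Relation.Binary.PropositionalEquality
open import Relation.Nullary using (¬_; Dec; does; yes; no; _because_; contradiction)
open import Relation.Nullary.Decidable
  using (⌊_⌋; map′; _×-dec_; _⊎-dec_; does-⇔; dec-true; dec-false)

isYes≡does : ∀ {A : Set} (d : Dec A) → ⌊ d ⌋ ≡ does d
isYes≡does (true because _) = refl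
isYes≡does (false because _) = refl

_≟L_ : ∀ {n} → DecidableEquality (Literal n)
lit u a ≟L lit v b =
  map′ (λ { (refl , refl) → refl }) (λ { refl → refl , refl }) ((u F.≟ v) ×-dec (a B.≟ b))

==-does : ∀ {n} (p q : Literal n) → (p == q) ≡ does (p ≟L q)
==-does (lit u a) (lit v b) = cong₂ _∧_ (isYes≡does (u F.≟ v)) (isYes≡does (a B.≟ b))

switchLit-pos : ∀ {n} (X : Subset n) p → switchLit X p ≡ lit (var p) (does (var p ∈? X) xor pos p)
switchLit-pos X (lit u a) with u ∈? X
... | yes _ = refl
... | no _ = refl

switchLit-involutive : ∀ {n} (X : Subset n) p → switchLit X (switchLit X p) ≡ p
switchLit-involutive X p rewrite switchLit-pos X (switchLit X p) | switchLit-pos X p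
  with does (var p ∈? X)
... | true = cong (lit (var p)) (not-involutive (pos p))
... | false = refl

-- Being an involution, switching is self-adjoint for the equality test.
switchLit-== : ∀ {n} (X : Subset n) p q → (switchLit X p == q) ≡ (p == switchLit X q)
switchLit-== X p q = begin
  (switchLit X p == q)        ≡⟨ ==-does (switchLit X p) q ⟩
  does (switchLit X p ≟L q)   ≡⟨ does-⇔ adjoint (switchLit X p ≟L q) (p ≟L switchLit X q) ⟩
  does (p ≟L switchLit X q)   ≡⟨ sym (==-does p (switchLit X q)) ⟩
  (p == switchLit X q)        ∎
  where
  open ≡-Reasoning
  adjoint : switchLit X p ≡ q ⇔ p ≡ switchLit X q
  adjoint = mk⇔ (λ { refl → sym (switchLit-involutive X p) })
                (λ { refl → switchLit-involutive X q })

count-map : ∀ {A B : Set} (t : B → Bool) (f : A → B) xs →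
  count t (map f xs) ≡ count (λ a → t (f a)) xs
count-map t f [] = refl
count-map t f (x ∷ xs) with t (f x)
... | true = cong suc (count-map t f xs)
... | false = count-map t f xs

count-cong : ∀ {A : Set} {t s : A → Bool} → (∀ a → t a ≡ s a) → ∀ xs → count t xs ≡ count s xs
count-cong e [] = refl
count-cong {s = s} e (x ∷ xs) rewrite e x with s x
... | true = cong suc (count-cong e xs)
... | false = count-cong e xs

c-switch : ∀ {n} (X : Subset n) F p → c (switch X F) p ≡ c F (switchLit X p)
c-switch X F p = trans (count-map _ (switchClause X) F) (count-cong contains-switch F)
  where
  contains-switch : ∀ C → contains (switchClause X C) p ≡ contains C (switchLit X p)
  contains-switch (clause a b _) = cong₂ _∨_ (switchLit-== X a p) (switchLit-== X b p)

c₂-switch : ∀ {n} (X : Subset n) F p q →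
  c₂ (switch X F) p q ≡ c₂ F (switchLit X p) (switchLit X q)
c₂-switch X F p q = trans (count-map _ (switchClause X) F) (count-cong is-pq-switch F)
  where
  is-pq-switch : ∀ C →
    ((l₁ (switchClause X C) == p) ∧ (l₂ (switchClause X C) == q)) ∨
    ((l₁ (switchClause X C) == q) ∧ (l₂ (switchClause X C) == p))
    ≡ ((l₁ C == switchLit X p) ∧ (l₂ C == switchLit X q)) ∨
      ((l₁ C == switchLit X q) ∧ (l₂ C == switchLit X p))
  is-pq-switch (clause a b _)
    rewrite switchLit-== X a p | switchLit-== X b q | switchLit-== X a q | switchLit-== X b p = refl

c₂-comm : ∀ {n} (F : Formula n) p q → c₂ F p q ≡ c₂ F q p
c₂-comm F p q = count-cong (λ C → ∨-comm ((l₁ C == p) ∧ (l₂ C == q)) ((l₁ C == q) ∧ (l₂ C == p))) F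

negateIf : Bool → ℤ → ℤ
negateIf true z = - z
negateIf false z = z

wV-switch : ∀ {n} (X : Subset n) F v → wV (switch X F) v ≡ negateIf (does (v ∈? X)) (wV F v)
wV-switch X F v
  rewrite c-switch X F (posL v) | c-switch X F (negL v)
        | switchLit-pos X (posL v) | switchLit-pos X (negL v)
  with does (v ∈? X)
... | true = flip (+ c F (posL v)) (+ c F (negL v))
  where
  flip : ∀ p q → q - p ≡ - (p - q)
  flip = solve-∀
... | false = refl

wE-switch : ∀ {n} (X : Subset n) F u v →
  wE (switch X F) u v ≡ negateIf (does (u ∈? X) xor does (v ∈? X)) (wE F u v)
wE-switch X F u v
  rewrite c₂-switch X F (posL u) (negL v) | c₂-switch X F (negL u) (posL v)
        | c₂-switch X F (posL u) (posL v) | c₂-switch X F (negL u) (negL v)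
        | switchLit-pos X (posL u) | switchLit-pos X (negL u)
        | switchLit-pos X (posL v) | switchLit-pos X (negL v)
  with does (u ∈? X) | does (v ∈? X)
... | true | true = both (+ c₂ F (posL u) (negL v)) (+ c₂ F (negL u) (posL v))
                         (+ c₂ F (posL u) (posL v)) (+ c₂ F (negL u) (negL v))
  where
  both : ∀ p q r s → (q + p) - s - r ≡ (p + q) - r - s
  both = solve-∀
... | true | false = onlyU (+ c₂ F (posL u) (negL v)) (+ c₂ F (negL u) (posL v))
                          (+ c₂ F (posL u) (posL v)) (+ c₂ F (negL u) (negL v))
  where
  onlyU : ∀ p q r s → (s + r) - q - p ≡ - ((p + q) - r - s)
  onlyU = solve-∀
... | false | true = onlyV (+ c₂ F (posL u) (negL v)) (+ c₂ F (negL u) (posL v))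
                          (+ c₂ F (posL u) (posL v)) (+ c₂ F (negL u) (negL v))
  where
  onlyV : ∀ p q r s → (r + s) - p - q ≡ - ((p + q) - r - s)
  onlyV = solve-∀
... | false | false = refl

wE-sym : ∀ {n} (F : Formula n) u v → wE F u v ≡ wE F v u
wE-sym F u v
  rewrite c₂-comm F (posL u) (negL v) | c₂-comm F (negL u) (posL v)
        | c₂-comm F (posL u) (posL v) | c₂-comm F (negL u) (negL v)
  = cong (λ z → z - + c₂ F (posL v) (posL u) - + c₂ F (negL v) (negL u))
         (ℤP.+-comm (+ c₂ F (negL v) (posL u)) (+ c₂ F (posL v) (negL u)))

noLoop : ∀ {n} (F : Formula n) u → ¬ EdgeG F u u
noLoop (C ∷ F) u (here (inj₁ (p , q))) = distinct C (trans p (sym q))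
noLoop (C ∷ F) u (here (inj₂ (p , q))) = distinct C (trans p (sym q))
noLoop (C ∷ F) u (there e) = noLoop F u e

Edge0-sym : ∀ {n} (F : Formula n) u v → Edge0 F u v → Edge0 F v u
Edge0-sym F u v (e , nonzero) = Any.map Sum.swap e , λ z → nonzero (trans (wE-sym F u v) z)

-- All sums in Defs are sums over Fin n of terms `if b then z else + 0`;
-- we name this guarded term and record how guards and sums interact.

guard : Bool → ℤ → ℤ
guard b z = if b then z else + 0

guard-0 : ∀ b → guard b (+ 0) ≡ + 0
guard-0 true = refl
guard-0 false = refl

guard-∧ : ∀ a b z → guard (a ∧ b) z ≡ guard a (guard b z)
guard-∧ true b z = refl
guard-∧ false b z = refl

guard-comm : ∀ a b z → guard a (guard b z) ≡ guard b (guard a z)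
guard-comm true b z = refl
guard-comm false b z = sym (guard-0 b)

guard-+ : ∀ a y z → guard a (y + z) ≡ guard a y + guard a z
guard-+ true y z = refl
guard-+ false y z = refl

guard-cong : ∀ {A : Set} (a? : Dec A) {y z} → (A → y ≡ z) → guard (does a?) y ≡ guard (does a?) z
guard-cong (yes a) e = e a
guard-cong (no _) e = refl

guard-mono : ∀ {A : Set} (a? : Dec A) {y z} → (A → y ≤ z) → guard (does a?) y ≤ guard (does a?) z
guard-mono (yes a) h = h a
guard-mono (no _) h = ℤP.≤-refl

guard-⊎ : ∀ {A B : Set} (a? : Dec A) (b? : Dec B) z → (A → B → ⊥) →
  guard (does (a? ⊎-dec b?)) z ≡ guard (does a?) z + guard (does b?) z
guard-⊎ (yes a) (yes b) z disjoint = contradiction b (disjoint a)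
guard-⊎ (yes a) (no _) z _ = sym (ℤP.+-identityʳ z)
guard-⊎ (no _) b? z _ = sym (ℤP.+-identityˡ (guard (does b?) z))

sum-cong : ∀ n {f g : Fin n → ℤ} → (∀ i → f i ≡ g i) → sumFin n f ≡ sumFin n g
sum-cong zero e = refl
sum-cong (suc n) e = cong₂ _+_ (e F.zero) (sum-cong n (λ i → e (F.suc i)))

sum-+ : ∀ n (f g : Fin n → ℤ) → sumFin n (λ i → f i + g i) ≡ sumFin n f + sumFin n g
sum-+ zero f g = refl
sum-+ (suc n) f g =
  trans (cong (λ s → (f F.zero + g F.zero) + s) (sum-+ n (λ i → f (F.suc i)) (λ i → g (F.suc i))))
        (interchange (f F.zero) (g F.zero) _ _)
  where
  interchange : ∀ a b c d → (a + b) + (c + d) ≡ (a + c) + (b + d)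
  interchange = solve-∀

sum-mono : ∀ n {f g : Fin n → ℤ} → (∀ i → f i ≤ g i) → sumFin n f ≤ sumFin n g
sum-mono zero h = ℤP.≤-refl
sum-mono (suc n) h = ℤP.+-mono-≤ (h F.zero) (sum-mono n (λ i → h (F.suc i)))

sum-zero : ∀ n → sumFin n (λ _ → + 0) ≡ + 0
sum-zero zero = refl
sum-zero (suc n) = trans (ℤP.+-identityˡ _) (sum-zero n)

sum-guard : ∀ n b (f : Fin n → ℤ) → sumFin n (λ i → guard b (f i)) ≡ guard b (sumFin n f)
sum-guard n true f = refl
sum-guard n false f = sum-zero n

sum-delta : ∀ n (x : Fin n) (g : Fin n → ℤ) → sumFin n (λ i → guard (does (i F.≟ x)) (g i)) ≡ g x
sum-delta (suc n) F.zero g =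
  trans (cong (λ s → g F.zero + s) (sum-zero n)) (ℤP.+-identityʳ (g F.zero))
sum-delta (suc n) (F.suc x) g = trans (ℤP.+-identityˡ _) (sum-delta n x (λ i → g (F.suc i)))

sum-subset-const : ∀ n (I : Subset n) z → sumFin n (λ v → guard (does (v ∈? I)) z) ≡ + ∣ I ∣ * z
sum-subset-const zero [] z = sym (ℤP.*-zeroˡ z)
sum-subset-const (suc n) (true ∷ I) z =
  trans (cong (λ s → z + s) (sum-subset-const n I z)) (sym (ℤP.suc-* (+ ∣ I ∣) z))
sum-subset-const (suc n) (false ∷ I) z = trans (ℤP.+-identityˡ _) (sum-subset-const n I z)

order-split : ∀ {n} (u v : Fin n) z → (u ≡ v → z ≡ + 0) →
  guard (does (toℕ u ℕ.<? toℕ v)) z + guard (does (toℕ v ℕ.<? toℕ u)) z ≡ z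
order-split u v z diagonal with FP.<-cmp u v
... | tri< u<v _ v≮u
  rewrite dec-true (toℕ u ℕ.<? toℕ v) u<v | dec-false (toℕ v ℕ.<? toℕ u) v≮u = ℤP.+-identityʳ z
... | tri≈ _ refl _
  rewrite dec-false (toℕ u ℕ.<? toℕ u) (ℕP.<-irrefl refl) = sym (diagonal refl)
... | tri> u≮v _ v<u
  rewrite dec-false (toℕ u ℕ.<? toℕ v) u≮v | dec-true (toℕ v ℕ.<? toℕ u) v<u = ℤP.+-identityˡ z

mem-tabulate : ∀ {n} (σ : Fin n → Bool) v → does (v ∈? tabulate σ) ≡ σ v
mem-tabulate σ F.zero with σ F.zero
... | true = refl
... | false = refl
mem-tabulate σ (F.suc v) = mem-tabulate (λ i → σ (F.suc i)) v

negateIf-+ : ∀ s a b → negateIf s a + negateIf s b ≡ negateIf s (a + b)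
negateIf-+ true a b = sym (ℤP.neg-distrib-+ a b)
negateIf-+ false a b = refl

negateIf-- : ∀ s a b → negateIf s a + negateIf (not s) b ≡ negateIf s (a - b)
negateIf-- true a b = negate-diff a b
  where
  negate-diff : ∀ a b → - a + b ≡ - (a - b)
  negate-diff = solve-∀
negateIf-- false a b = refl

negateIf-abs : ∀ z → negateIf (does (z ℤP.<? + 0)) z ≡ + ℤ.∣ z ∣
negateIf-abs (+ n) = refl
negateIf-abs ℤ.-[1+ n ] = refl

two≤abs-sum-diff : ∀ a b → b ≢ + 0 → 2 ℕ.≤ ℤ.∣ a + b ∣ ℕ.+ ℤ.∣ a - b ∣
two≤abs-sum-diff a b b≢0 = begin
  2                              ≤⟨ ℕP.*-monoʳ-≤ 2 (ℕP.n≢0⇒n>0 (b≢0 ∘ ℤP.∣i∣≡0⇒i≡0)) ⟩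
  2 ℕ.* ℤ.∣ b ∣                  ≡⟨ sym (ℤP.abs-* (+ 2) b) ⟩
  ℤ.∣ + 2 * b ∣                  ≡⟨ cong ℤ.∣_∣ (difference a b) ⟩
  ℤ.∣ (a + b) - (a - b) ∣        ≤⟨ ℤP.∣i-j∣≤∣i∣+∣j∣ (a + b) (a - b) ⟩
  ℤ.∣ a + b ∣ ℕ.+ ℤ.∣ a - b ∣    ∎
  where
  open ℕP.≤-Reasoning
  difference : ∀ a b → + 2 * b ≡ (a + b) - (a - b)
  difference = solve-∀

one-of-two : ∀ k p q → k * + 2 ≤ p + q → k ≤ p ⊎ k ≤ q
one-of-two k p q h with k ℤP.≤? p | k ℤP.≤? q
... | yes k≤p | _ = inj₁ k≤p
... | no _ | yes k≤q = inj₂ k≤q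
... | no k≰p | no k≰q =
  contradiction (ℤP.≤-trans (ℤP.≤-reflexive (double k)) h)
                (ℤP.<⇒≱ (ℤP.+-mono-< (ℤP.≰⇒> k≰p) (ℤP.≰⇒> k≰q)))
  where
  double : ∀ k → k + k ≡ k * + 2
  double = solve-∀

module InducedStar {n} (F : Formula n) (x : Fin n) (I : Subset n)
  (star : ∀ y → y ∈ I → Edge0 F x y)
  (indep : ∀ y z → y ∈ I → z ∈ I → ¬ Edge0 F y z) where

  U : Subset n
  U = ⁅ x ⁆ ∪ I

  x∉I : ¬ x ∈ I
  x∉I x∈I = noLoop F x (proj₁ (star x x∈I))

  ∈U⇔ : ∀ {v} → v ∈ U ⇔ (v ≡ x ⊎ v ∈ I)
  ∈U⇔ = mk⇔ (Sum.map₁ (Equivalence.to x∈⁅y⁆⇔x≡y) ∘ Equivalence.to ∪⇔⊎)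
            (Equivalence.from ∪⇔⊎ ∘ Sum.map₁ (Equivalence.from x∈⁅y⁆⇔x≡y))

  outEdge? : ∀ u v → Dec (u ≡ x × v ∈ I)
  outEdge? u v = (u F.≟ x) ×-dec (v ∈? I)

  edge⇔ : ∀ {u v} → (u ∈ U × v ∈ U × Edge0 F u v) ⇔ ((u ≡ x × v ∈ I) ⊎ (v ≡ x × u ∈ I))
  edge⇔ {u} {v} = mk⇔ to from
    where
    to : u ∈ U × v ∈ U × Edge0 F u v → (u ≡ x × v ∈ I) ⊎ (v ≡ x × u ∈ I)
    to (u∈U , v∈U , e) with Equivalence.to ∈U⇔ u∈U | Equivalence.to ∈U⇔ v∈U
    ... | inj₁ refl | inj₁ refl = contradiction (proj₁ e) (noLoop F x)
    ... | inj₁ refl | inj₂ v∈I = inj₁ (refl , v∈I)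
    ... | inj₂ u∈I | inj₁ refl = inj₂ (refl , u∈I)
    ... | inj₂ u∈I | inj₂ v∈I = contradiction e (indep u v u∈I v∈I)
    from : (u ≡ x × v ∈ I) ⊎ (v ≡ x × u ∈ I) → u ∈ U × v ∈ U × Edge0 F u v
    from (inj₁ (refl , v∈I)) =
      Equivalence.from ∈U⇔ (inj₁ refl) , Equivalence.from ∈U⇔ (inj₂ v∈I) , star v v∈I
    from (inj₂ (refl , u∈I)) =
      Equivalence.from ∈U⇔ (inj₂ u∈I) , Equivalence.from ∈U⇔ (inj₁ refl) , Edge0-sym F x u (star u u∈I)

  one-orientation : ∀ {u v} → u ≡ x × v ∈ I → v ≡ x × u ∈ I → ⊥
  one-orientation (refl , _) (refl , x∈I) = x∉I x∈I

  vertexSum : ∀ (f : Fin n → ℤ) →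
    sumFin n (λ v → guard (does (v ∈? U)) (f v)) ≡ f x + sumFin n (λ v → guard (does (v ∈? I)) (f v))
  vertexSum f = begin
    sumFin n (λ v → guard (does (v ∈? U)) (f v))
      ≡⟨ sum-cong n split ⟩
    sumFin n (λ v → guard (does (v F.≟ x)) (f v) + guard (does (v ∈? I)) (f v))
      ≡⟨ sum-+ n _ _ ⟩
    sumFin n (λ v → guard (does (v F.≟ x)) (f v)) + sumFin n (λ v → guard (does (v ∈? I)) (f v))
      ≡⟨ cong (_+ sumFin n (λ v → guard (does (v ∈? I)) (f v))) (sum-delta n x f) ⟩
    f x + sumFin n (λ v → guard (does (v ∈? I)) (f v)) ∎
    where
    open ≡-Reasoning
    split : ∀ v → guard (does (v ∈? U)) (f v) ≡ guard (does (v F.≟ x)) (f v) + guard (does (v ∈? I)) (f v)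
    split v = trans (cong (λ b → guard b (f v)) (does-⇔ ∈U⇔ (v ∈? U) ((v F.≟ x) ⊎-dec (v ∈? I))))
                    (guard-⊎ (v F.≟ x) (v ∈? I) (f v) (λ { refl → x∉I }))

  before : Fin n → Fin n → Bool
  before u v = does (toℕ u ℕ.<? toℕ v)

  -- Contribution of a pair u < v when u is the centre and v a leaf
  -- (fromCentre), resp. when v is the centre and u a leaf (toCentre).
  fromCentre toCentre : (Fin n → Fin n → ℤ) → Fin n → Fin n → ℤ
  fromCentre e u v = guard (before u v) (guard (does (v ∈? I)) (e u v))
  toCentre e u v = guard (before u v) (guard (does (u ∈? I)) (e u v))

  edgeTerm-split : ∀ (e : Fin n → Fin n → ℤ) u v →
    guard (before u v ∧ does (u ∈? U) ∧ does (v ∈? U) ∧ does (edge0? F u v)) (e u v)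
    ≡ guard (does (u F.≟ x)) (fromCentre e u v) + guard (does (v F.≟ x)) (toCentre e u v)
  edgeTerm-split e u v = begin
    guard (before u v ∧ does (u ∈? U) ∧ does (v ∈? U) ∧ does (edge0? F u v)) (e u v)
      ≡⟨ guard-∧ (before u v) _ (e u v) ⟩
    guard (before u v) (guard (does (u ∈? U) ∧ does (v ∈? U) ∧ does (edge0? F u v)) (e u v))
      ≡⟨ cong (λ b → guard (before u v) (guard b (e u v))) starEdges ⟩
    guard (before u v) (guard (does (outEdge? u v ⊎-dec outEdge? v u)) (e u v))
      ≡⟨ cong (guard (before u v)) (guard-⊎ (outEdge? u v) (outEdge? v u) (e u v) one-orientation) ⟩
    guard (before u v) (guard (does (outEdge? u v)) (e u v) + guard (does (outEdge? v u)) (e u v))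
      ≡⟨ guard-+ (before u v) _ _ ⟩
    guard (before u v) (guard (does (outEdge? u v)) (e u v)) + guard (before u v) (guard (does (outEdge? v u)) (e u v))
      ≡⟨ cong₂ _+_ (centreFirst (does (u F.≟ x)) (does (v ∈? I)))
                   (centreFirst (does (v F.≟ x)) (does (u ∈? I))) ⟩
    guard (does (u F.≟ x)) (fromCentre e u v) + guard (does (v F.≟ x)) (toCentre e u v) ∎
    where
    open ≡-Reasoning
    starEdges : does (u ∈? U) ∧ does (v ∈? U) ∧ does (edge0? F u v) ≡ does (outEdge? u v ⊎-dec outEdge? v u)
    starEdges = does-⇔ edge⇔ ((u ∈? U) ×-dec ((v ∈? U) ×-dec edge0? F u v)) (outEdge? u v ⊎-dec outEdge? v u)
    centreFirst : ∀ c l → guard (before u v) (guard (c ∧ l) (e u v)) ≡ guard c (guard (before u v) (guard l (e u v)))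
    centreFirst c l = trans (cong (guard (before u v)) (guard-∧ c l (e u v))) (guard-comm (before u v) c _)

  edgeSum : ∀ (e : Fin n → Fin n → ℤ) → (∀ u v → e u v ≡ e v u) →
    sumFin n (λ u → sumFin n (λ v →
      guard (before u v ∧ does (u ∈? U) ∧ does (v ∈? U) ∧ does (edge0? F u v)) (e u v)))
    ≡ sumFin n (λ v → guard (does (v ∈? I)) (e x v))
  edgeSum e e-sym = begin
    sumFin n (λ u → sumFin n (λ v →
      guard (before u v ∧ does (u ∈? U) ∧ does (v ∈? U) ∧ does (edge0? F u v)) (e u v)))
      ≡⟨ sum-cong n (λ u → sum-cong n (edgeTerm-split e u)) ⟩
    sumFin n (λ u → sumFin n (λ v →
      guard (does (u F.≟ x)) (fromCentre e u v) + guard (does (v F.≟ x)) (toCentre e u v)))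
      ≡⟨ sum-cong n (λ u → trans (sum-+ n _ _) (cong₂ _+_ (sum-guard n (does (u F.≟ x)) (fromCentre e u))
                                                              (sum-delta n x (toCentre e u)))) ⟩
    sumFin n (λ u → guard (does (u F.≟ x)) (sumFin n (fromCentre e u)) + toCentre e u x)
      ≡⟨ sum-+ n _ _ ⟩
    sumFin n (λ u → guard (does (u F.≟ x)) (sumFin n (fromCentre e u))) + sumFin n (λ u → toCentre e u x)
      ≡⟨ cong (_+ sumFin n (λ u → toCentre e u x)) (sum-delta n x (λ u → sumFin n (fromCentre e u))) ⟩
    sumFin n (fromCentre e x) + sumFin n (λ u → toCentre e u x)
      ≡⟨ sym (sum-+ n _ _) ⟩
    sumFin n (λ v → fromCentre e x v + toCentre e v x)
      ≡⟨ sum-cong n bothOrders ⟩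
    sumFin n (λ v → guard (does (v ∈? I)) (e x v)) ∎
    where
    open ≡-Reasoning
    bothOrders : ∀ v → fromCentre e x v + toCentre e v x ≡ guard (does (v ∈? I)) (e x v)
    bothOrders v =
      trans (cong (λ z → fromCentre e x v + guard (before v x) (guard (does (v ∈? I)) z)) (e-sym v x))
            (order-split x v (guard (does (v ∈? I)) (e x v))
                         (λ { refl → cong (λ b → guard b (e x x)) (dec-false (x ∈? I) x∉I) }))

  starWeight : ∀ F' →
    wInduced F' F U ≡ wV F' x + sumFin n (λ v → guard (does (v ∈? I)) (wV F' v + wE F' x v))
  starWeight F' = begin
    wSet F' U + wEdgesInduced F' F U
      ≡⟨ cong₂ _+_ (vertexSum (wV F')) (edgeSum (wE F') (wE-sym F')) ⟩
    (wV F' x + Σ[I] (wV F')) + Σ[I] (wE F' x)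
      ≡⟨ ℤP.+-assoc (wV F' x) _ _ ⟩
    wV F' x + (Σ[I] (wV F') + Σ[I] (wE F' x))
      ≡⟨ cong (λ s → wV F' x + s) (sym (trans (sum-cong n (λ v → guard-+ (does (v ∈? I)) _ _)) (sum-+ n _ _))) ⟩
    wV F' x + sumFin n (λ v → guard (does (v ∈? I)) (wV F' v + wE F' x v)) ∎
    where
    open ≡-Reasoning
    Σ[I] : (Fin n → ℤ) → ℤ
    Σ[I] f = sumFin n (λ v → guard (does (v ∈? I)) (f v))

  switchedWeight : ∀ (σ : Fin n → Bool) →
    wInduced (switch (tabulate σ) F) F U
    ≡ negateIf (σ x) (wV F x)
      + sumFin n (λ v → guard (does (v ∈? I))
                          (negateIf (σ v) (wV F v) + negateIf (σ x xor σ v) (wE F x v)))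
  switchedWeight σ =
    trans (starWeight (switch X F))
          (cong₂ _+_ (vertex x) (sum-cong n (λ v → cong (guard (does (v ∈? I))) (cong₂ _+_ (vertex v) (edge v)))))
    where
    X : Subset n
    X = tabulate σ
    vertex : ∀ v → wV (switch X F) v ≡ negateIf (σ v) (wV F v)
    vertex v = trans (wV-switch X F v) (cong (λ s → negateIf s (wV F v)) (mem-tabulate σ v))
    edge : ∀ v → wE (switch X F) x v ≡ negateIf (σ x xor σ v) (wE F x v)
    edge v = trans (wE-switch X F x v)
                   (cong (λ s → negateIf s (wE F x v)) (cong₂ _xor_ (mem-tabulate σ x) (mem-tabulate σ v)))

  a b : Fin n → ℤ
  a v = wV F v
  b v = wE F x v

  isNegative : ℤ → Bool
  isNegative z = does (z ℤP.<? + 0)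

  σ₁ : Fin n → Bool
  σ₁ v = does (v ∈? I) ∧ isNegative (a v + b v)

  weight₁ : wInduced (switch (tabulate σ₁) F) F U
            ≡ a x + sumFin n (λ v → guard (does (v ∈? I)) (+ ℤ.∣ a v + b v ∣))
  weight₁ = trans (switchedWeight σ₁) (cong₂ _+_ (cong (λ s → negateIf s (a x)) centre)
                                                 (sum-cong n (λ v → guard-cong (v ∈? I) (leaf v))))
    where
    centre : σ₁ x ≡ false
    centre = cong (_∧ isNegative (a x + b x)) (dec-false (x ∈? I) x∉I)
    leaf : ∀ v → v ∈ I → negateIf (σ₁ v) (a v) + negateIf (σ₁ x xor σ₁ v) (b v) ≡ + ℤ.∣ a v + b v ∣
    leaf v v∈I rewrite centre | dec-true (v ∈? I) v∈I =
      trans (negateIf-+ (isNegative (a v + b v)) (a v) (b v)) (negateIf-abs (a v + b v))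

  σ₂ : Fin n → Bool
  σ₂ v = does (v F.≟ x) ∨ (does (v ∈? I) ∧ isNegative (a v - b v))

  weight₂ : wInduced (switch (tabulate σ₂) F) F U
            ≡ - a x + sumFin n (λ v → guard (does (v ∈? I)) (+ ℤ.∣ a v - b v ∣))
  weight₂ = trans (switchedWeight σ₂) (cong₂ _+_ (cong (λ s → negateIf s (a x)) centre)
                                                 (sum-cong n (λ v → guard-cong (v ∈? I) (leaf v))))
    where
    centre : σ₂ x ≡ true
    centre = cong (_∨ (does (x ∈? I) ∧ isNegative (a x - b x))) (dec-true (x F.≟ x) refl)
    leaf : ∀ v → v ∈ I → negateIf (σ₂ v) (a v) + negateIf (σ₂ x xor σ₂ v) (b v) ≡ + ℤ.∣ a v - b v ∣
    leaf v v∈I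
      rewrite centre | dec-false (v F.≟ x) (λ { refl → x∉I v∈I }) | dec-true (v ∈? I) v∈I =
      trans (negateIf-- (isNegative (a v - b v)) (a v) (b v)) (negateIf-abs (a v - b v))

  weights-sum : + ∣ I ∣ * + 2
    ≤ wInduced (switch (tabulate σ₁) F) F U + wInduced (switch (tabulate σ₂) F) F U
  weights-sum = begin
    + ∣ I ∣ * + 2
      ≡⟨ sym (sum-subset-const n I (+ 2)) ⟩
    sumFin n (λ v → guard (does (v ∈? I)) (+ 2))
      ≤⟨ sum-mono n (λ v → guard-mono (v ∈? I)
                     (λ v∈I → ℤ.+≤+ (two≤abs-sum-diff (a v) (b v) (proj₂ (star v v∈I))))) ⟩
    sumFin n (λ v → guard (does (v ∈? I)) (+ ℤ.∣ a v + b v ∣ + + ℤ.∣ a v - b v ∣))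
      ≡⟨ trans (sum-cong n (λ v → guard-+ (does (v ∈? I)) _ _)) (sum-+ n _ _) ⟩
    S₁ + S₂
      ≡⟨ sym (cancel (a x) S₁ S₂) ⟩
    (a x + S₁) + (- a x + S₂)
      ≡⟨ sym (cong₂ _+_ weight₁ weight₂) ⟩
    wInduced (switch (tabulate σ₁) F) F U + wInduced (switch (tabulate σ₂) F) F U ∎
    where
    open ℤP.≤-Reasoning
    S₁ S₂ : ℤ
    S₁ = sumFin n (λ v → guard (does (v ∈? I)) (+ ℤ.∣ a v + b v ∣))
    S₂ = sumFin n (λ v → guard (does (v ∈? I)) (+ ℤ.∣ a v - b v ∣))
    cancel : ∀ p q r → (p + q) + (- p + r) ≡ q + r
    cancel = solve-∀

  tabulate⊆U : ∀ (σ : Fin n → Bool) → (∀ v → σ v ≡ true → v ≡ x ⊎ v ∈ I) → tabulate σ ⊆ U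
  tabulate⊆U σ h {v} v∈X =
    Equivalence.from ∈U⇔ (h v (trans (sym (mem-tabulate σ v)) (dec-true (v ∈? tabulate σ) v∈X)))

  X₁⊆U : tabulate σ₁ ⊆ U
  X₁⊆U = tabulate⊆U σ₁ leaf
    where
    leaf : ∀ v → σ₁ v ≡ true → v ≡ x ⊎ v ∈ I
    leaf v _ with v ∈? I
    leaf v _  | yes v∈I = inj₂ v∈I
    leaf v () | no _

  X₂⊆U : tabulate σ₂ ⊆ U
  X₂⊆U = tabulate⊆U σ₂ centreOrLeaf
    where
    centreOrLeaf : ∀ v → σ₂ v ≡ true → v ≡ x ⊎ v ∈ I
    centreOrLeaf v _ with v F.≟ x | v ∈? I
    centreOrLeaf v _  | yes v≡x | _ = inj₁ v≡x
    centreOrLeaf v _  | no _ | yes v∈I = inj₂ v∈I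
    centreOrLeaf v () | no _ | no _

lemma5p7 : ∀ {n} (F : Formula n) → ¬ HasSemicomplete F →
    (x : Fin n) (I : Subset n) → IsInducedStar F x I →
    Σ (Subset n) λ X → X ⊆ (⁅ x ⁆ ∪ I) ×
      (+ ∣ I ∣ ≤ wInduced (switch X F) F (⁅ x ⁆ ∪ I))
lemma5p7 F _ x I (_ , star , indep) = choose (one-of-two (+ ∣ I ∣) _ _ weights-sum)
  where
  open InducedStar F x I star indep
  choose : + ∣ I ∣ ≤ wInduced (switch (tabulate σ₁) F) F U ⊎ + ∣ I ∣ ≤ wInduced (switch (tabulate σ₂) F) F U →
    Σ (Subset _) λ X → X ⊆ U × (+ ∣ I ∣ ≤ wInduced (switch X F) F U)
  choose (inj₁ bound₁) = tabulate σ₁ , X₁⊆U , bound₁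
  choose (inj₂ bound₂) = tabulate σ₂ , X₂⊆U , bound₂
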